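{- Let $\alpha', \beta'$ be odd integers and $\gamma$ an integer, and let $q(n) = \frac{\alpha'}{2} n^2 + \frac{\beta'}{2} n + \gamma$ for $n \geq 0$ (an integer for every integer $n$). Then $D_q(n) = 2^{\lceil \log_2 n \rceil}$ for all integers $n \geq 1$ if and only if $\alpha' = \beta'$.
   Context: For an integer sequence $s = (s(i))_{i \geq 0}$ and an integer $n \geq 1$, the discriminator $D_s(n)$ is the least positive integer $m$ such that $s(0), \ldots, s(n-1)$ are pairwise incongruent modulo $m$. If two of $s(0), \ldots, s(n-1)$ are equal, no such $m$ exists, and then $D_s(n) \neq 2^{\lceil \log_2 n \rceil}$ is understood to hold. -}

module Defs where

open import Data.Nat as ℕ using (ℕ; _<_; _≤_)
open import Data.Integer as ℤ using (ℤ; +_; _-_; _+_; _*_)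
open import Data.Integer.DivMod using (_/ℕ_)
open import Data.Integer.Divisibility using (_∣_)
open import Data.Product using (_×_)
open import Relation.Nullary using (¬_)
open import Relation.Binary.PropositionalEquality using (_≡_)

Odd : ℤ → Set
Odd a = ¬ (+ 2 ∣ a)

-- q(n) = (α' n² + β' n)/2 + γ ; for odd α', β' the numerator
-- n (α' n + β') is always even, so the division by 2 is exact.
q : ℤ → ℤ → ℤ → ℕ → ℤ
q α′ β′ γ n = ((α′ * (+ n * + n) + β′ * + n) /ℕ 2) + γ

PairwiseIncongruent : (ℕ → ℤ) → ℕ → ℕ → Set
PairwiseIncongruent s n m =
  ∀ i j → i < n → j < n → ¬ (i ≡ j) → ¬ (+ m ∣ (s i - s j))

-- If no such m exists (two values coincide), this is false for every k,
-- matching the convention that D_s(n) ≠ 2^⌈log₂ n⌉ then holds.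
DiscriminatorIs : (ℕ → ℤ) → ℕ → ℕ → Set
DiscriminatorIs s n k =
  1 ℕ.≤ k × PairwiseIncongruent s n k ×
  (∀ m → 1 ℕ.≤ m → m < k → ¬ PairwiseIncongruent s n m)

-- For odd α′ and β′ the numerator of q is even, and 2 (q (j + D) − q j) = D (α′ (2j + D) + β′).
-- If α′ = β′ this is α′ · D · (2j + D + 1), where D and 2j + D + 1 have opposite parity.  When
-- n ≤ 2^k both factors lie below 2^(k+1), so 2^k divides no difference.  When 2^(k−1) < n, every
-- m < 2^k arises: write 2m = 2^(e+1) c with c odd, let D be the smaller of c and 2^(e+1) and
-- 2j + D + 1 the larger; then j + D = 2^e + (c − 1)/2 < n.
-- If α′ ≠ β′, write α′ − β′ = 2^(s+1) w with w odd; then 2 (q (2^s) − q (2^s − 1)) equals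
-- 2^(s+1) (α′ − w), which 2^(s+2) divides, so D_q(2^(s+1)) ≠ 2^(s+1).

module Submission where

open import Defs
open import Data.Integer using (ℤ; _≟_)
open import Data.Nat using (ℕ; _≤_; _^_)
open import Data.Nat.Logarithm using (⌈log₂_⌉; ⌈log₂2^n⌉≡n)
open import Data.Nat.Properties using (m^n>0)
open import Data.Product using (∃-syntax; ∃₂; _×_; _,_; proj₁; proj₂)
open import Data.Sum using (_⊎_; inj₁; inj₂; [_,_]′)
open import Function using (_∘_)
open import Function.Bundles using (_⇔_; mk⇔)
open import Relation.Nullary using (¬_; contradiction; yes; no)
open import Relation.Nullary.Decidable using (decidable-stable)
open import Relation.Binary.PropositionalEquality
  using (_≡_; _≢_; refl; sym; trans; cong; cong₂; subst; subst₂; module ≡-Reasoning)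

module _ where
  open import Data.Nat
  open import Data.Nat.Properties
  open import Data.Nat.Divisibility
  open import Data.Nat.Induction using (<-rec)
  open import Data.Nat.Logarithm
  open import Data.Nat.Tactic.RingSolver using (solve-∀)
  open import Relation.Binary.Definitions using (tri<; tri≈; tri>)

  even-or-odd : ∀ n → (∃[ k ] n ≡ 2 * k) ⊎ (∃[ k ] n ≡ suc (2 * k))
  even-or-odd zero = inj₁ (0 , refl)
  even-or-odd (suc n) with even-or-odd n
  ... | inj₁ (k , refl) = inj₂ (k , refl)
  ... | inj₂ (k , refl) = inj₁ (suc k , sym (*-suc 2 k))

  2∤1+2* : ∀ k → ¬ 2 ∣ suc (2 * k)
  2∤1+2* k (divides q eq) = even≢odd q k (trans (*-comm 2 q) (sym eq))

  2∤⇒≡1+2* : ∀ {n} → ¬ 2 ∣ n → ∃[ k ] n ≡ suc (2 * k)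
  2∤⇒≡1+2* {n} 2∤n with even-or-odd n
  ... | inj₁ (k , refl) = contradiction (m∣m*n k) 2∤n
  ... | inj₂ odd = odd

  n*n+n-even : ∀ n → ∃[ t ] n * n + n ≡ 2 * t
  n*n+n-even zero = 0 , refl
  n*n+n-even (suc n) with n*n+n-even n
  ... | t , n*n+n≡2t =
    t + suc n , trans (step n) (trans (cong (_+ 2 * suc n) n*n+n≡2t) (sym (*-distribˡ-+ 2 t (suc n))))
    where
    step : ∀ n → suc n * suc n + suc n ≡ n * n + n + 2 * suc n
    step = solve-∀

  2-adic : ∀ m → 0 < m → ∃₂ λ e c → m ≡ 2 ^ e * suc (2 * c)
  2-adic = <-rec _ split
    where
    split : ∀ m → (∀ {k} → k < m → 0 < k → ∃₂ λ e c → k ≡ 2 ^ e * suc (2 * c)) →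
            0 < m → ∃₂ λ e c → m ≡ 2 ^ e * suc (2 * c)
    split m rec 0<m with even-or-odd m
    ... | inj₂ (c , refl) = 0 , c , sym (*-identityˡ _)
    ... | inj₁ (suc k , refl) with rec (m<m+n (suc k) z<s) z<s
    ...   | e , c , k≡ = suc e , c , trans (cong (2 *_) k≡) (sym (*-assoc 2 (2 ^ e) _))

  2^k∣*odd⇒2^k∣ : ∀ k c {m} → 2 ^ k ∣ m * suc (2 * c) → 2 ^ k ∣ m
  2^k∣*odd⇒2^k∣ zero c {m} _ = 1∣ m
  2^k∣*odd⇒2^k∣ (suc k) c {m} 2^[1+k]∣m*odd with 2∣m
    where
    2∣m : 2 ∣ m
    2∣m = ∣m+n∣m⇒∣n (subst (2 ∣_) (trans (*-suc m (2 * c)) (+-comm m _))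
                                   (∣-trans (m∣m*n (2 ^ k)) 2^[1+k]∣m*odd))
                    (∣n⇒∣m*n m (m∣m*n c))
  ... | divides h refl = subst (2 ^ suc k ∣_) (*-comm 2 h) (*-monoʳ-∣ 2 (2^k∣*odd⇒2^k∣ k c {h} 2^k∣h*odd))
    where
    2^k∣h*odd : 2 ^ k ∣ h * suc (2 * c)
    2^k∣h*odd = *-cancelˡ-∣ 2 (subst (2 ^ suc k ∣_) (regroup h (suc (2 * c))) 2^[1+k]∣m*odd)
      where
      regroup : ∀ h x → h * 2 * x ≡ 2 * (h * x)
      regroup = solve-∀

  2^k∣*⇒2^k∣⊎2^k∣ : ∀ k {x y} s → x + y ≡ suc (2 * s) → 2 ^ k ∣ x * y → 2 ^ k ∣ x ⊎ 2 ^ k ∣ y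
  2^k∣*⇒2^k∣⊎2^k∣ k {x} {y} s x+y≡odd 2^k∣x*y with even-or-odd x
  ... | inj₂ (c , refl) = inj₂ (2^k∣*odd⇒2^k∣ k c (subst (2 ^ k ∣_) (*-comm (suc (2 * c)) y) 2^k∣x*y))
  ... | inj₁ (c , refl) with 2∤⇒≡1+2* 2∤y
    where
    2∤y : ¬ 2 ∣ y
    2∤y 2∣y = 2∤1+2* s (subst (2 ∣_) x+y≡odd (∣m∣n⇒∣m+n (m∣m*n c) 2∣y))
  ...   | d , refl = inj₁ (2^k∣*odd⇒2^k∣ k d 2^k∣x*y)

  2^k∤*-opposite-parity : ∀ k {x y} s → 0 < x → 0 < y → x < 2 ^ k → y < 2 ^ k →
                          x + y ≡ suc (2 * s) → ¬ 2 ^ k ∣ x * y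
  2^k∤*-opposite-parity k s 0<x 0<y x<2^k y<2^k x+y≡odd 2^k∣x*y =
    [ (λ 2^k∣x → <⇒≱ x<2^k (∣⇒≤ {{>-nonZero 0<x}} 2^k∣x))
    , (λ 2^k∣y → <⇒≱ y<2^k (∣⇒≤ {{>-nonZero 0<y}} 2^k∣y))
    ]′ (2^k∣*⇒2^k∣⊎2^k∣ k s x+y≡odd 2^k∣x*y)

  2^m<2^[1+n]⇒2^m≤2^n : ∀ m n → 2 ^ m < 2 ^ suc n → 2 ^ m ≤ 2 ^ n
  2^m<2^[1+n]⇒2^m≤2^n m n 2^m<2^[1+n] with m ≤? n
  ... | yes m≤n = ^-monoʳ-≤ 2 m≤n
  ... | no m≰n = contradiction (^-monoʳ-≤ 2 (≰⇒> m≰n)) (<⇒≱ 2^m<2^[1+n])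

  2^e*odd<2^[1+k]⇒2^e+c≤2^k : ∀ e c k → 2 ^ e * suc (2 * c) < 2 ^ suc k → 2 ^ e + c ≤ 2 ^ k
  2^e*odd<2^[1+k]⇒2^e+c≤2^k e zero k lt
    rewrite *-identityʳ (2 ^ e) | +-identityʳ (2 ^ e) = 2^m<2^[1+n]⇒2^m≤2^n e k lt
  2^e*odd<2^[1+k]⇒2^e+c≤2^k e (suc c) k lt with 2 ^ e | m^n>0 2 e
  ... | suc p | _ = *-cancelˡ-≤ 2 (begin
      2 * (suc p + suc c)            ≤⟨ m≤m+n _ (p + 2 * p * c) ⟩
      2 * (suc p + suc c) + (p + 2 * p * c) ≡⟨ expand p c ⟩
      suc (suc p * suc (2 * suc c))  ≤⟨ lt ⟩
      2 * 2 ^ k                      ∎)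
    where
    open ≤-Reasoning
    expand : ∀ p c → 2 * (suc p + suc c) + (p + 2 * p * c) ≡ suc (suc p * suc (2 * suc c))
    expand = solve-∀

  n≤2^⌈log₂n⌉ : ∀ n → n ≤ 2 ^ ⌈log₂ n ⌉
  n≤2^⌈log₂n⌉ = <-rec _ bound
    where
    bound : ∀ n → (∀ {m} → m < n → m ≤ 2 ^ ⌈log₂ m ⌉) → n ≤ 2 ^ ⌈log₂ n ⌉
    bound 0 _ = z≤n
    bound 1 _ = s≤s z≤n
    bound n@(suc (suc n′)) rec = begin
      n                         ≡⟨ sym (⌊n/2⌋+⌈n/2⌉≡n n) ⟩
      ⌊ n /2⌋ + ⌈ n /2⌉         ≤⟨ +-monoˡ-≤ ⌈ n /2⌉ (⌊n/2⌋≤⌈n/2⌉ n) ⟩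
      ⌈ n /2⌉ + ⌈ n /2⌉         ≡⟨ cong (⌈ n /2⌉ +_) (sym (+-identityʳ ⌈ n /2⌉)) ⟩
      2 * ⌈ n /2⌉               ≤⟨ *-monoʳ-≤ 2 (rec (⌈n/2⌉<n n′)) ⟩
      2 * 2 ^ ⌈log₂ ⌈ n /2⌉ ⌉   ≡⟨ cong (λ l → 2 ^ suc l) (⌈log₂⌈n/2⌉⌉≡⌈log₂n⌉∸1 n) ⟩
      2 ^ (1 + (⌈log₂ n ⌉ ∸ 1)) ≡⟨ cong (2 ^_) (m+[n∸m]≡n 1≤⌈log₂n⌉) ⟩
      2 ^ ⌈log₂ n ⌉             ∎
      where
      open ≤-Reasoning
      1≤⌈log₂n⌉ : 1 ≤ ⌈log₂ n ⌉
      1≤⌈log₂n⌉ = ⌈log₂⌉-mono-≤ {2} {n} (s≤s (s≤s z≤n))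

  ⌈log₂n⌉≡1+k⇒2^k<n : ∀ {n k} → ⌈log₂ n ⌉ ≡ suc k → 2 ^ k < n
  ⌈log₂n⌉≡1+k⇒2^k<n {n} {k} ⌈log₂n⌉≡1+k = ≰⇒> λ n≤2^k →
    <⇒≱ (n<1+n k) (subst₂ _≤_ ⌈log₂n⌉≡1+k (⌈log₂2^n⌉≡n k) (⌈log₂⌉-mono-≤ n≤2^k))

  ordered-factorisation : ∀ {x y} s → x < y → x + y ≡ suc (2 * s) →
                          ∃[ j ] j + x ≡ s × x * (1 + 2 * j + x) ≡ x * y
  ordered-factorisation {x} s x<y x+y≡odd with m≤n⇒∃[o]m+o≡n x<y
  ... | t , refl with even-or-odd t
  ...   | inj₁ (j , refl) =
    j , *-cancelˡ-≡ (j + x) s 2 (suc-injective (trans (regroup x j) x+y≡odd)) , cong (x *_) (reorder x j)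
    where
    regroup : ∀ x j → suc (2 * (j + x)) ≡ x + (suc x + 2 * j)
    regroup = solve-∀
    reorder : ∀ x j → 1 + 2 * j + x ≡ suc x + 2 * j
    reorder = solve-∀
  ...   | inj₂ (j , refl) = contradiction (trans (regroup x j) x+y≡odd) (even≢odd (suc (x + j)) s)
    where
    regroup : ∀ x j → 2 * suc (x + j) ≡ x + (suc x + suc (2 * j))
    regroup = solve-∀

  opposite-parity-factorisation : ∀ {x y} s → 0 < x → 0 < y → x + y ≡ suc (2 * s) →
                                  ∃₂ λ j D → 0 < D × j + D ≡ s × D * (1 + 2 * j + D) ≡ x * y
  opposite-parity-factorisation {x} {y} s 0<x 0<y x+y≡odd with <-cmp x y
  ... | tri< x<y _ _ = let j , j+x≡s , eq = ordered-factorisation s x<y x+y≡odd in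
                       j , x , 0<x , j+x≡s , eq
  ... | tri≈ _ refl _ = contradiction (trans (cong (x +_) (+-identityʳ x)) x+y≡odd) (even≢odd x s)
  ... | tri> _ _ y<x = let j , j+y≡s , eq = ordered-factorisation s y<x (trans (+-comm y x) x+y≡odd) in
                       j , y , 0<y , j+y≡s , trans eq (*-comm y x)

module _ where
  open import Data.Integer using (ℤ; +_; -[1+_]; _+_; _*_; _-_; -_; ∣_∣; 0ℤ; 1ℤ)
  open import Data.Integer.DivMod using (_/ℕ_; _%ℕ_; n%ℕd<d; a≡a%ℕn+[a/ℕn]*n)
  open import Data.Integer.Properties
    using ( pos-+; pos-*; abs-*; +-comm; +-identityˡ; *-identityˡ; *-cancelʳ-≡; *-cancelˡ-≡
          ; ∣i∣≡0⇒i≡0; i-j≡0⇒i≡j )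
  open import Data.Integer.Tactic.RingSolver using (solve-∀)
  open import Data.Nat using (suc; s≤s)
  import Data.Nat as ℕ
  import Data.Nat.Properties as ℕ
  import Data.Nat.Divisibility as ℕ
  open ≡-Reasoning

  +[1+2*c]≡2*c+1 : ∀ c → + suc (2 ℕ.* c) ≡ + 2 * + c + 1ℤ
  +[1+2*c]≡2*c+1 c =
    trans (pos-+ 1 (2 ℕ.* c)) (trans (cong (λ x → 1ℤ + x) (pos-* 2 c)) (+-comm 1ℤ (+ 2 * + c)))

  ∣i∣≡k*[1+2c]⇒i≡k*[2w+1] : ∀ i k c → ∣ i ∣ ≡ k ℕ.* suc (2 ℕ.* c) →
                            ∃[ w ] i ≡ + k * (+ 2 * w + 1ℤ)
  ∣i∣≡k*[1+2c]⇒i≡k*[2w+1] (+ n) k c refl =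
    + c , trans (pos-* k _) (cong (+ k *_) (+[1+2*c]≡2*c+1 c))
  ∣i∣≡k*[1+2c]⇒i≡k*[2w+1] -[1+ n ] k c ∣i∣≡ = -[1+ c ] , (begin
    - + suc n                          ≡⟨ cong (-_ ∘ +_) ∣i∣≡ ⟩
    - + (k ℕ.* suc (2 ℕ.* c))          ≡⟨ cong -_ (trans (pos-* k _) (cong (+ k *_) (+[1+2*c]≡2*c+1 c))) ⟩
    - (+ k * (+ 2 * + c + 1ℤ))         ≡⟨ negate (+ k) (+ c) ⟩
    + k * (+ 2 * - (1ℤ + + c) + 1ℤ)    ≡⟨ cong (λ x → + k * (+ 2 * - x + 1ℤ)) (sym (pos-+ 1 c)) ⟩
    + k * (+ 2 * -[1+ c ] + 1ℤ)        ∎)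
    where
    negate : ∀ k c → - (k * (+ 2 * c + 1ℤ)) ≡ k * (+ 2 * - (1ℤ + c) + 1ℤ)
    negate = solve-∀

  odd⇒≡2*a+1 : ∀ α → Odd α → ∃[ a ] α ≡ + 2 * a + 1ℤ
  odd⇒≡2*a+1 α oα with 2∤⇒≡1+2* {∣ α ∣} oα
  ... | c , ∣α∣≡1+2c
    with ∣i∣≡k*[1+2c]⇒i≡k*[2w+1] α 1 c (trans ∣α∣≡1+2c (sym (ℕ.*-identityˡ (suc (2 ℕ.* c)))))
  ... | a , α≡ = a , trans α≡ (*-identityˡ (+ 2 * a + 1ℤ))

  2-adicℤ : ∀ d → d ≢ 0ℤ → ∃₂ λ e w → d ≡ + (2 ℕ.^ e) * (+ 2 * w + 1ℤ)
  2-adicℤ d d≢0 with 2-adic ∣ d ∣ (ℕ.n≢0⇒n>0 (d≢0 ∘ ∣i∣≡0⇒i≡0))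
  ... | e , c , ∣d∣≡ = e , ∣i∣≡k*[1+2c]⇒i≡k*[2w+1] d (2 ℕ.^ e) c ∣d∣≡

  [i*2]/ℕ2≡i : ∀ i → (i * + 2) /ℕ 2 ≡ i
  [i*2]/ℕ2≡i i with (i * + 2) %ℕ 2 | n%ℕd<d (i * + 2) 2 | a≡a%ℕn+[a/ℕn]*n (i * + 2) 2
  ... | 0 | _ | i*2≡Q*2 = sym (*-cancelʳ-≡ i _ (+ 2) (trans i*2≡Q*2 (+-identityˡ ((i * + 2) /ℕ 2 * + 2))))
  ... | 1 | _ | i*2≡1+Q*2 = contradiction 2∣i-Q∣≡1 (ℕ.even≢odd ∣ i - Q ∣ 0)
    where
    Q = (i * + 2) /ℕ 2
    shift : ∀ i Q → (i - Q) * + 2 ≡ i * + 2 - Q * + 2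
    shift = solve-∀
    cancel : ∀ Q → 1ℤ + Q * + 2 - Q * + 2 ≡ 1ℤ
    cancel = solve-∀
    2∣i-Q∣≡1 : 2 ℕ.* ∣ i - Q ∣ ≡ 1
    2∣i-Q∣≡1 = begin
      2 ℕ.* ∣ i - Q ∣          ≡⟨ ℕ.*-comm 2 ∣ i - Q ∣ ⟩
      ∣ i - Q ∣ ℕ.* 2          ≡⟨ sym (abs-* (i - Q) (+ 2)) ⟩
      ∣ (i - Q) * + 2 ∣        ≡⟨ cong ∣_∣ (shift i Q) ⟩
      ∣ i * + 2 - Q * + 2 ∣    ≡⟨ cong (λ x → ∣ x - Q * + 2 ∣) i*2≡1+Q*2 ⟩
      ∣ 1ℤ + Q * + 2 - Q * + 2 ∣ ≡⟨ cong ∣_∣ (cancel Q) ⟩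
      1                        ∎
  ... | suc (suc _) | s≤s (s≤s ()) | _

  q-double : ∀ α β γ n → Odd α → Odd β → + 2 * q α β γ n ≡ α * (+ n * + n) + β * + n + + 2 * γ
  q-double α β γ n oα oβ with odd⇒≡2*a+1 α oα | odd⇒≡2*a+1 β oβ | n*n+n-even n
  ... | a , refl | b , refl | t , n*n+n≡2t = begin
    + 2 * (N /ℕ 2 + γ)            ≡⟨ cong (λ x → + 2 * (x /ℕ 2 + γ)) N≡X*2 ⟩
    + 2 * ((X * + 2) /ℕ 2 + γ)    ≡⟨ cong (λ x → + 2 * (x + γ)) ([i*2]/ℕ2≡i X) ⟩
    + 2 * (X + γ)                 ≡⟨ distrib X γ ⟩
    X * + 2 + + 2 * γ             ≡⟨ cong (_+ + 2 * γ) (sym N≡X*2) ⟩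
    N + + 2 * γ                   ∎
    where
    N X : ℤ
    N = (+ 2 * a + 1ℤ) * (+ n * + n) + (+ 2 * b + 1ℤ) * + n
    X = a * (+ n * + n) + b * + n + + t
    distrib : ∀ X γ → + 2 * (X + γ) ≡ X * + 2 + + 2 * γ
    distrib = solve-∀
    split : ∀ a b n → (+ 2 * a + 1ℤ) * (n * n) + (+ 2 * b + 1ℤ) * n
                    ≡ + 2 * (a * (n * n) + b * n) + (n * n + n)
    split = solve-∀
    merge : ∀ a b n t → + 2 * (a * (n * n) + b * n) + + 2 * t ≡ (a * (n * n) + b * n + t) * + 2
    merge = solve-∀
    +n*+n++n≡2*+t : + n * + n + + n ≡ + 2 * + t
    +n*+n++n≡2*+t = begin
      + n * + n + + n   ≡⟨ cong (_+ + n) (sym (pos-* n n)) ⟩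
      + (n ℕ.* n) + + n ≡⟨ sym (pos-+ (n ℕ.* n) n) ⟩
      + (n ℕ.* n ℕ.+ n) ≡⟨ cong +_ n*n+n≡2t ⟩
      + (2 ℕ.* t)       ≡⟨ pos-* 2 t ⟩
      + 2 * + t         ∎
    N≡X*2 : N ≡ X * + 2
    N≡X*2 = begin
      N                                                     ≡⟨ split a b (+ n) ⟩
      + 2 * (a * (+ n * + n) + b * + n) + (+ n * + n + + n) ≡⟨ cong (λ x → + 2 * (a * (+ n * + n) + b * + n) + x)
                                                                    +n*+n++n≡2*+t ⟩
      + 2 * (a * (+ n * + n) + b * + n) + + 2 * + t         ≡⟨ merge a b (+ n) (+ t) ⟩
      X * + 2                                               ∎

  q-diff : ∀ α β γ j D → Odd α → Odd β →
           + 2 * (q α β γ (j ℕ.+ D) - q α β γ j) ≡ + D * (α * (+ 2 * + j + + D) + β)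
  q-diff α β γ j D oα oβ = begin
    + 2 * (q α β γ (j ℕ.+ D) - q α β γ j)
      ≡⟨ distrib (q α β γ (j ℕ.+ D)) (q α β γ j) ⟩
    + 2 * q α β γ (j ℕ.+ D) - + 2 * q α β γ j
      ≡⟨ cong₂ _-_ (q-double α β γ (j ℕ.+ D) oα oβ) (q-double α β γ j oα oβ) ⟩
    (α * (+ (j ℕ.+ D) * + (j ℕ.+ D)) + β * + (j ℕ.+ D) + + 2 * γ) - (α * (+ j * + j) + β * + j + + 2 * γ)
      ≡⟨ cong (λ i → (α * (i * i) + β * i + + 2 * γ) - (α * (+ j * + j) + β * + j + + 2 * γ)) (pos-+ j D) ⟩
    (α * ((+ j + + D) * (+ j + + D)) + β * (+ j + + D) + + 2 * γ) - (α * (+ j * + j) + β * + j + + 2 * γ)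
      ≡⟨ factor α β γ (+ j) (+ D) ⟩
    + D * (α * (+ 2 * + j + + D) + β) ∎
    where
    distrib : ∀ x y → + 2 * (x - y) ≡ + 2 * x - + 2 * y
    distrib = solve-∀
    factor : ∀ α β γ j D →
             (α * ((j + D) * (j + D)) + β * (j + D) + + 2 * γ) - (α * (j * j) + β * j + + 2 * γ)
             ≡ D * (α * (+ 2 * j + D) + β)
    factor = solve-∀

  2*∣Δqαα∣≡∣α∣*D*[1+2j+D] : ∀ α γ j D → Odd α →
    2 ℕ.* ∣ q α α γ (j ℕ.+ D) - q α α γ j ∣ ≡ ∣ α ∣ ℕ.* (D ℕ.* (1 ℕ.+ 2 ℕ.* j ℕ.+ D))
  2*∣Δqαα∣≡∣α∣*D*[1+2j+D] α γ j D oα = begin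
    2 ℕ.* ∣ Δ ∣                                ≡⟨ sym (abs-* (+ 2) Δ) ⟩
    ∣ + 2 * Δ ∣                                ≡⟨ cong ∣_∣ (q-diff α α γ j D oα oα) ⟩
    ∣ + D * (α * (+ 2 * + j + + D) + α) ∣      ≡⟨ cong ∣_∣ (factor α (+ j) (+ D)) ⟩
    ∣ α * (+ D * (1ℤ + + 2 * + j + + D)) ∣     ≡⟨ cong (λ x → ∣ α * x ∣) (sym +D*[1+2j+D]) ⟩
    ∣ α * + (D ℕ.* (1 ℕ.+ 2 ℕ.* j ℕ.+ D)) ∣    ≡⟨ abs-* α _ ⟩
    ∣ α ∣ ℕ.* (D ℕ.* (1 ℕ.+ 2 ℕ.* j ℕ.+ D))    ∎
    where
    Δ : ℤ
    Δ = q α α γ (j ℕ.+ D) - q α α γ j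
    factor : ∀ α j D → D * (α * (+ 2 * j + D) + α) ≡ α * (D * (1ℤ + + 2 * j + D))
    factor = solve-∀
    +D*[1+2j+D] : + (D ℕ.* (1 ℕ.+ 2 ℕ.* j ℕ.+ D)) ≡ + D * (1ℤ + + 2 * + j + + D)
    +D*[1+2j+D] = begin
      + (D ℕ.* (1 ℕ.+ 2 ℕ.* j ℕ.+ D))     ≡⟨ pos-* D _ ⟩
      + D * + (1 ℕ.+ 2 ℕ.* j ℕ.+ D)       ≡⟨ cong (+ D *_) (pos-+ (1 ℕ.+ 2 ℕ.* j) D) ⟩
      + D * (+ (1 ℕ.+ 2 ℕ.* j) + + D)     ≡⟨ cong (λ x → + D * (x + + D)) (pos-+ 1 (2 ℕ.* j)) ⟩
      + D * (1ℤ + + (2 ℕ.* j) + + D)      ≡⟨ cong (λ x → + D * (1ℤ + x + + D)) (pos-* 2 j) ⟩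
      + D * (1ℤ + + 2 * + j + + D)        ∎

  α≢β⇒q-congruent : ∀ α β γ → Odd α → Odd β → α ≢ β →
                     ∃[ s ] ¬ PairwiseIncongruent (q α β γ) (2 ℕ.^ s) (2 ℕ.^ s)
  α≢β⇒q-congruent α β γ oα oβ α≢β with odd⇒≡2*a+1 α oα | odd⇒≡2*a+1 β oβ
  ... | a , refl | b , refl with 2-adicℤ (a - b) (α≢β ∘ cong (λ x → + 2 * x + 1ℤ) ∘ i-j≡0⇒i≡j a b)
  ... | e , w , a-b≡2^e*[2w+1] with ℕ.m≤n⇒∃[o]m+o≡n (ℕ.m^n>0 2 e)
  ... | j , 1+j≡2^e = suc e , λ incongruent →
    incongruent (j ℕ.+ 1) j j+1<N (ℕ.<-trans j<j+1 j+1<N) (λ j+1≡j → ℕ.<-irrefl (sym j+1≡j) j<j+1) N∣Δ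
    where
    N : ℕ
    N = 2 ℕ.^ suc e
    Δ : ℤ
    Δ = q (+ 2 * a + 1ℤ) (+ 2 * b + 1ℤ) γ (j ℕ.+ 1) - q (+ 2 * a + 1ℤ) (+ 2 * b + 1ℤ) γ j
    j<j+1 : j ℕ.< j ℕ.+ 1
    j<j+1 = ℕ.m<m+n j ℕ.z<s
    j+1<N : j ℕ.+ 1 ℕ.< N
    j+1<N = subst₂ ℕ._<_ (trans (sym 1+j≡2^e) (ℕ.+-comm 1 j)) (ℕ.*-comm (2 ℕ.^ e) 2)
                   (ℕ.m<m*n (2 ℕ.^ e) 2 {{ℕ.m^n≢0 2 e}} (s≤s (s≤s ℕ.z≤n)))
    expand : ∀ a b j → + 1 * ((+ 2 * a + 1ℤ) * (+ 2 * j + + 1) + (+ 2 * b + 1ℤ))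
                       ≡ (+ 2 * a + 1ℤ) * (+ 2 * (1ℤ + j)) - + 2 * (a - b)
    expand = solve-∀
    collect : ∀ a w P → (+ 2 * a + 1ℤ) * (+ 2 * P) - + 2 * (P * (+ 2 * w + 1ℤ))
                      ≡ + 2 * (+ 2 * P * (a - w))
    collect = solve-∀
    2Δ≡2*N*[a-w] : + 2 * Δ ≡ + 2 * (+ N * (a - w))
    2Δ≡2*N*[a-w] = begin
      + 2 * Δ
        ≡⟨ q-diff (+ 2 * a + 1ℤ) (+ 2 * b + 1ℤ) γ j 1 oα oβ ⟩
      + 1 * ((+ 2 * a + 1ℤ) * (+ 2 * + j + + 1) + (+ 2 * b + 1ℤ))
        ≡⟨ expand a b (+ j) ⟩
      (+ 2 * a + 1ℤ) * (+ 2 * (1ℤ + + j)) - + 2 * (a - b)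
        ≡⟨ cong₂ (λ P d → (+ 2 * a + 1ℤ) * (+ 2 * P) - + 2 * d) 1+j≡P a-b≡2^e*[2w+1] ⟩
      (+ 2 * a + 1ℤ) * (+ 2 * P) - + 2 * (P * (+ 2 * w + 1ℤ))
        ≡⟨ collect a w P ⟩
      + 2 * (+ 2 * P * (a - w))
        ≡⟨ cong (λ x → + 2 * (x * (a - w))) (sym (pos-* 2 (2 ℕ.^ e))) ⟩
      + 2 * (+ N * (a - w))
        ∎
      where
      P : ℤ
      P = + (2 ℕ.^ e)
      1+j≡P : 1ℤ + + j ≡ P
      1+j≡P = trans (sym (pos-+ 1 j)) (cong +_ 1+j≡2^e)
    ∣Δ∣≡N*∣a-w∣ : ∣ Δ ∣ ≡ N ℕ.* ∣ a - w ∣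
    ∣Δ∣≡N*∣a-w∣ = trans (cong ∣_∣ (*-cancelˡ-≡ (+ 2) Δ _ 2Δ≡2*N*[a-w])) (abs-* (+ N) (a - w))
    N∣Δ : N ℕ.∣ ∣ Δ ∣
    N∣Δ = subst (N ℕ.∣_) (sym ∣Δ∣≡N*∣a-w∣) (ℕ.m∣m*n ∣ a - w ∣)

module _ where
  open import Data.Nat
  open import Data.Nat.Properties
  open import Data.Nat.Divisibility
  open import Data.Nat.Tactic.RingSolver using (solve-∀)
  open import Data.Integer as ℤ using (∣_∣)
  open import Data.Integer.Properties using (∣i-j∣≡∣j-i∣)
  open import Relation.Binary.Definitions using (tri<; tri≈; tri>)

  2^k∤Δqαα : ∀ α γ k {n i j} → Odd α → j < i → i < n → n ≤ 2 ^ k →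
               ¬ 2 ^ k ∣ ∣ q α α γ i ℤ.- q α α γ j ∣
  2^k∤Δqαα α γ k {n} {i} {j} oα j<i i<n n≤2^k with m≤n⇒∃[o]m+o≡n (<⇒≤ j<i)
  ... | zero , refl = contradiction j<i (<-irrefl (sym (+-identityʳ j)))
  ... | D@(suc _) , refl = λ 2^k∣Δ →
    2^k∤*-opposite-parity (suc k) (j + D) z<s z<s (<-trans D<E E<2^[1+k]) E<2^[1+k] (D+E j D)
      (2^[1+k]∣D*E 2^k∣Δ)
    where
    E : ℕ
    E = 1 + 2 * j + D
    D+E : ∀ j D → D + (1 + 2 * j + D) ≡ suc (2 * (j + D))
    D+E = solve-∀
    D<E : D < E
    D<E = s≤s (m≤n+m D (2 * j))
    E<2^[1+k] : E < 2 ^ suc k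
    E<2^[1+k] = begin-strict
      1 + 2 * j + D  ≡⟨ regroup j D ⟩
      suc j + i      <⟨ +-mono-≤-< (≤-<-trans (m≤m+n j D) i<n) i<n ⟩
      n + n          ≤⟨ +-mono-≤ n≤2^k n≤2^k ⟩
      2 ^ k + 2 ^ k  ≡⟨ cong (2 ^ k +_) (sym (+-identityʳ (2 ^ k))) ⟩
      2 ^ suc k      ∎
      where
      open ≤-Reasoning
      regroup : ∀ j D → 1 + 2 * j + D ≡ suc j + (j + D)
      regroup = solve-∀
    2^[1+k]∣D*E : 2 ^ k ∣ ∣ q α α γ i ℤ.- q α α γ j ∣ → 2 ^ suc k ∣ D * E
    2^[1+k]∣D*E 2^k∣Δ with 2∤⇒≡1+2* {∣ α ∣} oα
    ... | c , ∣α∣≡1+2c =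
      2^k∣*odd⇒2^k∣ (suc k) c (subst (2 ^ suc k ∣_) 2∣Δ∣≡D*E*[1+2c] (*-monoʳ-∣ 2 2^k∣Δ))
      where
      2∣Δ∣≡D*E*[1+2c] : 2 * ∣ q α α γ i ℤ.- q α α γ j ∣ ≡ D * E * suc (2 * c)
      2∣Δ∣≡D*E*[1+2c] = trans (2*∣Δqαα∣≡∣α∣*D*[1+2j+D] α γ j D oα)
                              (trans (cong (_* (D * E)) ∣α∣≡1+2c) (*-comm (suc (2 * c)) (D * E)))

  qαα-incongruent : ∀ α γ k {n} → Odd α → n ≤ 2 ^ k → PairwiseIncongruent (q α α γ) n (2 ^ k)
  qαα-incongruent α γ k {n} oα n≤2^k i j i<n j<n i≢j with <-cmp i j
  ... | tri< i<j _ _ =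
    2^k∤Δqαα α γ k oα i<j j<n n≤2^k ∘ subst (2 ^ k ∣_) (∣i-j∣≡∣j-i∣ (q α α γ i) (q α α γ j))
  ... | tri≈ _ i≡j _ = contradiction i≡j i≢j
  ... | tri> _ _ j<i = 2^k∤Δqαα α γ k oα j<i i<n n≤2^k

  qαα-congruent : ∀ α γ k {n m} → Odd α → 2 ^ k < n → 0 < m → m < 2 ^ suc k →
                    ¬ PairwiseIncongruent (q α α γ) n m
  qαα-congruent α γ k {n} {m} oα 2^k<n 0<m m<2^[1+k] with 2-adic m 0<m
  ... | e , c , refl
    with opposite-parity-factorisation {suc (2 * c)} {2 ^ suc e} (2 ^ e + c) z<s (m^n>0 2 (suc e))
                                        (odd+even (2 ^ e) c)
    where
    odd+even : ∀ P c → suc (2 * c) + 2 * P ≡ suc (2 * (P + c))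
    odd+even = solve-∀
  ... | j , D , 0<D , j+D≡2^e+c , D*E≡[1+2c]*2^[1+e] = λ incongruent →
    incongruent (j + D) j j+D<n (≤-<-trans (m≤m+n j D) j+D<n)
                (λ j+D≡j → <-irrefl (sym j+D≡j) (m<m+n j 0<D)) m∣Δ
    where
    j+D<n : j + D < n
    j+D<n = ≤-<-trans (subst (_≤ 2 ^ k) (sym j+D≡2^e+c) (2^e*odd<2^[1+k]⇒2^e+c≤2^k e c k m<2^[1+k])) 2^k<n
    regroup : ∀ P c a → a * (suc (2 * c) * (2 * P)) ≡ 2 * (a * (P * suc (2 * c)))
    regroup = solve-∀
    ∣Δ∣≡∣α∣*m : ∣ q α α γ (j + D) ℤ.- q α α γ j ∣ ≡ ∣ α ∣ * (2 ^ e * suc (2 * c))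
    ∣Δ∣≡∣α∣*m = *-cancelˡ-≡ _ _ 2 (trans (2*∣Δqαα∣≡∣α∣*D*[1+2j+D] α γ j D oα)
                                   (trans (cong (∣ α ∣ *_) D*E≡[1+2c]*2^[1+e]) (regroup (2 ^ e) c ∣ α ∣)))
    m∣Δ : 2 ^ e * suc (2 * c) ∣ ∣ q α α γ (j + D) ℤ.- q α α γ j ∣
    m∣Δ = subst (2 ^ e * suc (2 * c) ∣_) (sym ∣Δ∣≡∣α∣*m) (n∣m*n ∣ α ∣)

  qαα-discriminator : ∀ α γ {n} → Odd α → 1 ≤ n → DiscriminatorIs (q α α γ) n (2 ^ ⌈log₂ n ⌉)
  qαα-discriminator α γ {n} oα 1≤n =
    ≤-trans 1≤n (n≤2^⌈log₂n⌉ n) , qαα-incongruent α γ ⌈log₂ n ⌉ oα (n≤2^⌈log₂n⌉ n) , least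
    where
    least : ∀ m → 1 ≤ m → m < 2 ^ ⌈log₂ n ⌉ → ¬ PairwiseIncongruent (q α α γ) n m
    least m 1≤m m<2^L with ⌈log₂ n ⌉ in ⌈log₂n⌉≡L
    ... | zero = contradiction 1≤m (<⇒≱ m<2^L)
    ... | suc k = qαα-congruent α γ k oα (⌈log₂n⌉≡1+k⇒2^k<n ⌈log₂n⌉≡L) 1≤m m<2^L

theorem11 : (α′ β′ γ : ℤ) → Odd α′ → Odd β′ →
    ((∀ (n : ℕ) → 1 ≤ n → DiscriminatorIs (q α′ β′ γ) n (2 ^ ⌈log₂ n ⌉)) ⇔ (α′ ≡ β′))
theorem11 α′ β′ γ oα′ oβ′ = mk⇔ coefficients-equal (λ { refl n → qαα-discriminator α′ γ oα′ })
  where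
  coefficients-equal : (∀ n → 1 ≤ n → DiscriminatorIs (q α′ β′ γ) n (2 ^ ⌈log₂ n ⌉)) → α′ ≡ β′
  coefficients-equal discriminates = decidable-stable (α′ ≟ β′) λ α′≢β′ →
    let s , ¬incongruent = α≢β⇒q-congruent α′ β′ γ oα′ oβ′ α′≢β′
        incongruent = proj₁ (proj₂ (discriminates (2 ^ s) (m^n>0 2 s)))
    in ¬incongruent (subst (PairwiseIncongruent (q α′ β′ γ) (2 ^ s) ∘ (2 ^_)) (⌈log₂2^n⌉≡n s) incongruent)
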